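{- For the distance game $\textsc{Cis}_2$ played on paths, the polynomial profiles satisfy, for $n\ge 4$, \[P_{\textsc{Cis}_2,P_{n}}(x,y)=P_{\textsc{Cis}_2,P_{n-1}}(x,y)+(x+y)P_{\textsc{Cis}_2,P_{n-3}}(x,y)+(x^2+y^2+2xy)P_{\textsc{Cis}_2,P_{n-4}}(x,y),\] with initial values $P_{\textsc{Cis}_2,P_0}=1$, $P_{\textsc{Cis}_2,P_1}=1+x+y$, $P_{\textsc{Cis}_2,P_2}=1+2x+2y+x^2+y^2+2xy$, $P_{\textsc{Cis}_2,P_3}=1+3x+3y+2x^2+2y^2+4xy$. Consequently the total number of positions satisfies \[P_{\textsc{Cis}_2,P_{n}}(1,1)=P_{\textsc{Cis}_2,P_{n-1}}(1,1)+2P_{\textsc{Cis}_2,P_{n-3}}(1,1)+4P_{\textsc{Cis}_2,P_{n-4}}(1,1)\quad (n\ge4),\] with initial values $1,3,9,15$ for $n=0,1,2,3$.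
   Context: A distance game given by a pair of sets $(S,D)$ of positive integers is played on a finite graph by two players, Left (colouring vertices blue) and Right (colouring vertices red). A position is any assignment to a subset of the vertices of the colours blue or red (other vertices empty) such that no two vertices of the same colour are at graph distance in $S$ and no two vertices of different colours are at graph distance in $D$; no assumption of alternating play is made. $\textsc{Cis}_2$ is the distance game with $S=D=\{2\}$. The polynomial profile of a game $G$ on a board $B$ is $P_{G,B}(x,y)=\sum f_{j,l}x^jy^l$, where $f_{j,l}$ is the number of positions with exactly $j$ blue and $l$ red vertices. $P_n$ denotes the path with $n$ vertices; $P_0$ is the empty board. -}

module Defs where

open import Data.Nat using (ℕ; zero; suc; _+_; _*_; _∸_; _≡ᵇ_; ∣_-_∣)
open import Data.Bool using (Bool; true; false; _∧_; not; if_then_else_)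
open import Data.List using (List; []; _∷_; map; concatMap; length; filterᵇ; allFin; upTo)
open import Data.Bool.ListAction using (all; any)
open import Data.Nat.ListAction using (sum)
open import Data.Vec using (Vec; []; _∷_; lookup)
open import Data.Fin using (Fin; toℕ)
open import Relation.Binary.PropositionalEquality using (_≡_)

data Colour : Set where
  empty blue red : Colour

pathDist : {n : ℕ} → Fin n → Fin n → ℕ
pathDist i j = ∣ toℕ i - toℕ j ∣

-- A distance game (S , D) with S, D finite sets of positive integers,
-- given as lists.

_∈ᵇ_ : ℕ → List ℕ → Bool
d ∈ᵇ xs = any (λ s → d ≡ᵇ s) xs

pairOK : List ℕ → List ℕ → ℕ → Colour → Colour → Bool
pairOK S D d empty c = true
pairOK S D d blue empty = true
pairOK S D d red empty = true
pairOK S D d blue blue = not (d ∈ᵇ S)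
pairOK S D d red red = not (d ∈ᵇ S)
pairOK S D d blue red = not (d ∈ᵇ D)
pairOK S D d red blue = not (d ∈ᵇ D)

-- A colouring of the path P_n is a position of the game (S , D) iff no
-- two (distinct) vertices violate the distance rules.  (Distances in S
-- and D are positive, so the pair i = j is never constrained.)
isPositionᵇ : List ℕ → List ℕ → (n : ℕ) → Vec Colour n → Bool
isPositionᵇ S D n v =
  all (λ i → all (λ j → pairOK S D (pathDist i j) (lookup v i) (lookup v j)) (allFin n)) (allFin n)

colourings : (n : ℕ) → List (Vec Colour n)
colourings zero = [] ∷ []
colourings (suc n) =
  concatMap (λ v → (empty ∷ v) ∷ (blue ∷ v) ∷ (red ∷ v) ∷ []) (colourings n)

count : Colour → {n : ℕ} → Vec Colour n → ℕ
count c [] = 0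
count empty (empty ∷ v) = suc (count empty v)
count blue (blue ∷ v) = suc (count blue v)
count red (red ∷ v) = suc (count red v)
count c (_ ∷ v) = count c v

positions : List ℕ → List ℕ → (n : ℕ) → List (Vec Colour n)
positions S D n = filterᵇ (isPositionᵇ S D n) (colourings n)

-- Polynomials in x, y with natural coefficients, represented by their
-- coefficient functions: p j l is the coefficient of x^j y^l.

Poly : Set
Poly = ℕ → ℕ → ℕ

_≋_ : Poly → Poly → Set
p ≋ q = ∀ j l → p j l ≡ q j l
infix 4 _≋_


Σ≤ : ℕ → (ℕ → ℕ) → ℕ
Σ≤ n f = sum (map f (upTo (suc n)))

mono : ℕ → ℕ → Poly
mono a b j l = if (j ≡ᵇ a) ∧ (l ≡ᵇ b) then 1 else 0

const : ℕ → Poly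
const c j l = c * mono 0 0 j l

X : Poly
X = mono 1 0

Y : Poly
Y = mono 0 1

_⊕_ : Poly → Poly → Poly
(p ⊕ q) j l = p j l + q j l
infixl 6 _⊕_

_⊗_ : Poly → Poly → Poly
(p ⊗ q) j l = Σ≤ j (λ a → Σ≤ l (λ b → p a b * q (j ∸ a) (l ∸ b)))
infixl 7 _⊗_

profile : List ℕ → List ℕ → (n : ℕ) → Poly
profile S D n j l =
  length (filterᵇ (λ v → (count blue v ≡ᵇ j) ∧ (count red v ≡ᵇ l)) (positions S D n))

Cis2 : (n : ℕ) → Poly
Cis2 = profile (2 ∷ []) (2 ∷ [])

-- Evaluation at (1,1) of a polynomial all of whose monomials have
-- degree at most d in x and at most d in y: the sum of its coefficients.
eval11 : ℕ → Poly → ℕ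
eval11 d p = Σ≤ d (λ j → Σ≤ d (λ l → p j l))

module Submission where

-- Since S = D = {2}, colours never matter to the rules of Cis₂: a colouring of a path is a
-- position exactly when no two coloured vertices are at distance 2 (it is "separated").
-- Split a separated colouring of P_n at its first vertex. If that vertex is empty, the rest
-- is a separated colouring of P_{n-1}. If it is coloured, the vertex two places further is
-- empty; either the second vertex is empty too, leaving a separated colouring of P_{n-3}, or
-- it is coloured, which empties the fourth vertex as well and leaves one of P_{n-4}.
-- Weighting blue vertices by x and red ones by y turns this into the recurrence for the
-- profile. Every colouring of P_n has exactly one profile (j, l) with j, l ≤ n, so
-- eval11 n (Cis2 n) is the number of positions, which satisfies the same split with x = y = 1.

open import Defs
open import Algebra using (CommutativeMonoid)
open import Data.Bool using (Bool; true; false; _∧_; not; if_then_else_)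
open import Data.Bool.ListAction using (all)
open import Data.Bool.Properties
  using (∧-comm; ∧-zeroʳ; ∧-identityʳ; ∧-assoc; ∧-idem; ∧-commutativeMonoid)
open import Data.Fin using (Fin; toℕ) renaming (zero to fzero; suc to fsuc)
open import Data.List
  using (List; []; _∷_; map; length; filterᵇ; concatMap; tabulate; allFin; upTo)
open import Data.List.Properties using (map-cong; map-applyUpTo)
open import Data.Nat using (ℕ; zero; suc; _+_; _*_; _∸_; _≤_; z≤n; s≤s; _≡ᵇ_)
open import Data.Nat.ListAction using (sum)
open import Data.Nat.Properties
  using (+-identityʳ; *-assoc; *-distribˡ-+; *-distribʳ-+; *-zeroʳ; m≤n⇒m≤1+n;
         +-commutativeSemigroup)
open import Data.Nat.Solver using (module +-*-Solver)
open import Data.Product using (_×_; _,_)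
open import Data.Vec using (Vec; []; _∷_; lookup)
open import Function using (_∘_)
open import Relation.Binary.PropositionalEquality
  using (_≡_; refl; sym; trans; cong; cong₂; module ≡-Reasoning)
open import Algebra.Properties.CommutativeSemigroup +-commutativeSemigroup
  using () renaming (interchange to +-interchange)
open import Algebra.Properties.CommutativeSemigroup
  (CommutativeMonoid.commutativeSemigroup ∧-commutativeMonoid)
  using () renaming (interchange to ∧-interchange)

open ≡-Reasoning
open +-*-Solver using (solve; _:+_; _:*_; _:=_; con)

-- Lists and finite sums

indicator : Bool → ℕ
indicator b = if b then 1 else 0

module _ {A : Set} where

  length-filterᵇ-∷ : ∀ (p : A → Bool) x xs →
    length (filterᵇ p (x ∷ xs)) ≡ indicator (p x) + length (filterᵇ p xs)
  length-filterᵇ-∷ p x xs with p x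
  ... | true  = refl
  ... | false = refl

  filterᵇ-cong : ∀ {p q : A → Bool} → (∀ x → p x ≡ q x) → ∀ xs →
                 filterᵇ p xs ≡ filterᵇ q xs
  filterᵇ-cong e [] = refl
  filterᵇ-cong {p} {q} e (x ∷ xs) with p x | q x | e x
  ... | true  | .true  | refl = cong (x ∷_) (filterᵇ-cong e xs)
  ... | false | .false | refl = filterᵇ-cong e xs

  filterᵇ-none : ∀ {p : A → Bool} → (∀ x → p x ≡ false) → ∀ xs → filterᵇ p xs ≡ []
  filterᵇ-none e [] = refl
  filterᵇ-none {p} e (x ∷ xs) with p x | e x
  ... | false | refl = filterᵇ-none e xs

  filterᵇ-filterᵇ : ∀ (p q : A → Bool) xs →
                    filterᵇ q (filterᵇ p xs) ≡ filterᵇ (λ x → p x ∧ q x) xs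
  filterᵇ-filterᵇ p q [] = refl
  filterᵇ-filterᵇ p q (x ∷ xs) with p x
  ... | false = filterᵇ-filterᵇ p q xs
  ... | true with q x
  ...   | true  = cong (x ∷_) (filterᵇ-filterᵇ p q xs)
  ...   | false = filterᵇ-filterᵇ p q xs

  all-cong : ∀ {p q : A → Bool} → (∀ x → p x ≡ q x) → ∀ xs → all p xs ≡ all q xs
  all-cong e [] = refl
  all-cong e (x ∷ xs) = cong₂ _∧_ (e x) (all-cong e xs)

  all-true : ∀ {p : A → Bool} → (∀ x → p x ≡ true) → ∀ xs → all p xs ≡ true
  all-true e [] = refl
  all-true e (x ∷ xs) = cong₂ _∧_ (e x) (all-true e xs)

  all-∧ : ∀ (p q : A → Bool) xs → all (λ x → p x ∧ q x) xs ≡ all p xs ∧ all q xs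
  all-∧ p q [] = refl
  all-∧ p q (x ∷ xs) = trans (cong ((p x ∧ q x) ∧_) (all-∧ p q xs))
                             (∧-interchange (p x) (q x) (all p xs) (all q xs))

  sum-map-+ : ∀ (f g : A → ℕ) xs →
              sum (map (λ x → f x + g x) xs) ≡ sum (map f xs) + sum (map g xs)
  sum-map-+ f g [] = refl
  sum-map-+ f g (x ∷ xs) =
    trans (cong (f x + g x +_) (sum-map-+ f g xs)) (+-interchange (f x) (g x) _ _)

  sum-map-* : ∀ c (f : A → ℕ) xs → sum (map (λ x → c * f x) xs) ≡ c * sum (map f xs)
  sum-map-* c f [] = sym (*-zeroʳ c)
  sum-map-* c f (x ∷ xs) =
    trans (cong (c * f x +_) (sum-map-* c f xs)) (sym (*-distribˡ-+ c (f x) _))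

all-tabulate : ∀ {A : Set} {n} (p : A → Bool) (f : Fin n → A) →
               all p (tabulate f) ≡ all (p ∘ f) (allFin n)
all-tabulate {n = zero}  p f = refl
all-tabulate {n = suc n} p f =
  cong (p (f fzero) ∧_) (trans (all-tabulate p (f ∘ fsuc)) (sym (all-tabulate (p ∘ f) fsuc)))

all-allFin-suc : ∀ {n} (p : Fin (suc n) → Bool) →
                 all p (allFin (suc n)) ≡ p fzero ∧ all (p ∘ fsuc) (allFin n)
all-allFin-suc p = cong (p fzero ∧_) (all-tabulate p fsuc)

Σ≤-suc : ∀ n f → Σ≤ (suc n) f ≡ f 0 + Σ≤ n (f ∘ suc)
Σ≤-suc n f = cong (λ xs → f 0 + sum xs)
  (trans (map-applyUpTo suc f (suc n)) (sym (map-applyUpTo (λ i → i) (f ∘ suc) (suc n))))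

Σ≤-cong : ∀ n {f g : ℕ → ℕ} → (∀ i → f i ≡ g i) → Σ≤ n f ≡ Σ≤ n g
Σ≤-cong n e = cong sum (map-cong e (upTo (suc n)))

Σ≤-+ : ∀ n (f g : ℕ → ℕ) → Σ≤ n (λ i → f i + g i) ≡ Σ≤ n f + Σ≤ n g
Σ≤-+ n f g = sum-map-+ f g (upTo (suc n))

Σ≤-* : ∀ n c (f : ℕ → ℕ) → Σ≤ n (λ i → c * f i) ≡ c * Σ≤ n f
Σ≤-* n c f = sum-map-* c f (upTo (suc n))

Σ≤-zero : ∀ n → Σ≤ n (λ _ → 0) ≡ 0
Σ≤-zero n = Σ≤-* n 0 (λ _ → 0)

Σ≤-head : ∀ n (f : ℕ → ℕ) → (∀ i → f (suc i) ≡ 0) → Σ≤ n f ≡ f 0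
Σ≤-head zero    f e = +-identityʳ (f 0)
Σ≤-head (suc n) f e = begin
  Σ≤ (suc n) f            ≡⟨ Σ≤-suc n f ⟩
  f 0 + Σ≤ n (f ∘ suc)    ≡⟨ cong (f 0 +_) (trans (Σ≤-cong n e) (Σ≤-zero n)) ⟩
  f 0 + 0                 ≡⟨ +-identityʳ (f 0) ⟩
  f 0                     ∎

Σ≤-indicator-≡ᵇ : ∀ {c n} → c ≤ n → Σ≤ n (λ i → indicator (c ≡ᵇ i)) ≡ 1
Σ≤-indicator-≡ᵇ {n = zero}  z≤n = refl
Σ≤-indicator-≡ᵇ {n = suc n} z≤n =
  trans (Σ≤-suc n (λ i → indicator (0 ≡ᵇ i))) (cong suc (Σ≤-zero n))
Σ≤-indicator-≡ᵇ {suc c} {suc n} (s≤s c≤n) =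
  trans (Σ≤-suc n (λ i → indicator (suc c ≡ᵇ i))) (Σ≤-indicator-≡ᵇ c≤n)

-- Polynomial arithmetic

scale : ℕ → Poly → Poly
scale c p j l = c * p j l

xTimes : Poly → Poly
xTimes p zero    l = 0
xTimes p (suc j) l = p j l

yTimes : Poly → Poly
yTimes p j zero    = 0
yTimes p j (suc l) = p j l

xTimes-cong : ∀ {p q} → p ≋ q → xTimes p ≋ xTimes q
xTimes-cong e zero    l = refl
xTimes-cong e (suc j) l = e j l

yTimes-cong : ∀ {p q} → p ≋ q → yTimes p ≋ yTimes q
yTimes-cong e j zero    = refl
yTimes-cong e j (suc l) = e j l

yTimes-xTimes : ∀ p → yTimes (xTimes p) ≋ xTimes (yTimes p)
yTimes-xTimes p zero    zero    = refl
yTimes-xTimes p zero    (suc l) = refl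
yTimes-xTimes p (suc j) zero    = refl
yTimes-xTimes p (suc j) (suc l) = refl

⊗-congˡ : ∀ {p q} r → p ≋ q → p ⊗ r ≋ q ⊗ r
⊗-congˡ r e j l = Σ≤-cong j (λ a → Σ≤-cong l (λ b → cong (_* r (j ∸ a) (l ∸ b)) (e a b)))

⊗-congʳ : ∀ p {q r} → q ≋ r → p ⊗ q ≋ p ⊗ r
⊗-congʳ p e j l = Σ≤-cong j (λ a → Σ≤-cong l (λ b → cong (p a b *_) (e (j ∸ a) (l ∸ b))))

⊗-distribʳ-⊕ : ∀ p q r → (p ⊕ q) ⊗ r ≋ p ⊗ r ⊕ q ⊗ r
⊗-distribʳ-⊕ p q r j l = begin
  Σ≤ j (λ a → Σ≤ l (λ b → (p a b + q a b) * r (j ∸ a) (l ∸ b)))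
    ≡⟨ Σ≤-cong j (λ a → trans (Σ≤-cong l (λ b → *-distribʳ-+ (r (j ∸ a) (l ∸ b)) (p a b) (q a b)))
                              (Σ≤-+ l (pr a) (qr a))) ⟩
  Σ≤ j (λ a → Σ≤ l (pr a) + Σ≤ l (qr a))
    ≡⟨ Σ≤-+ j (λ a → Σ≤ l (pr a)) (λ a → Σ≤ l (qr a)) ⟩
  (p ⊗ r) j l + (q ⊗ r) j l ∎
  where
  pr qr : ℕ → ℕ → ℕ
  pr a b = p a b * r (j ∸ a) (l ∸ b)
  qr a b = q a b * r (j ∸ a) (l ∸ b)

scale-⊗ : ∀ c p q → scale c p ⊗ q ≋ scale c (p ⊗ q)
scale-⊗ c p q j l = begin
  Σ≤ j (λ a → Σ≤ l (λ b → c * p a b * q (j ∸ a) (l ∸ b)))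
    ≡⟨ Σ≤-cong j (λ a → trans (Σ≤-cong l (λ b → *-assoc c (p a b) _)) (Σ≤-* l c (pq a))) ⟩
  Σ≤ j (λ a → c * Σ≤ l (pq a))
    ≡⟨ Σ≤-* j c (λ a → Σ≤ l (pq a)) ⟩
  c * (p ⊗ q) j l ∎
  where
  pq : ℕ → ℕ → ℕ
  pq a b = p a b * q (j ∸ a) (l ∸ b)

xTimes-⊗ : ∀ p q → xTimes p ⊗ q ≋ xTimes (p ⊗ q)
xTimes-⊗ p q zero    l = cong (_+ 0) (Σ≤-zero l)
xTimes-⊗ p q (suc j) l =
  trans (Σ≤-suc j (λ a → Σ≤ l (λ b → xTimes p a b * q (suc j ∸ a) (l ∸ b))))
        (cong (_+ (p ⊗ q) j l) (Σ≤-zero l))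

yTimes-⊗ : ∀ p q → yTimes p ⊗ q ≋ yTimes (p ⊗ q)
yTimes-⊗ p q j zero    = Σ≤-zero j
yTimes-⊗ p q j (suc l) =
  Σ≤-cong j (λ a → Σ≤-suc l (λ b → yTimes p a b * q (j ∸ a) (suc l ∸ b)))

⊗-identityˡ : ∀ p → mono 0 0 ⊗ p ≋ p
⊗-identityˡ p j l = begin
  (mono 0 0 ⊗ p) j l
    ≡⟨ Σ≤-head j (λ a → Σ≤ l (λ b → mono 0 0 a b * p (j ∸ a) (l ∸ b))) (λ a → Σ≤-zero l) ⟩
  Σ≤ l (λ b → mono 0 0 0 b * p j (l ∸ b))
    ≡⟨ Σ≤-head l (λ b → mono 0 0 0 b * p j (l ∸ b)) (λ b → refl) ⟩
  p j l + 0
    ≡⟨ +-identityʳ (p j l) ⟩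
  p j l ∎

X≋xTimes-1 : X ≋ xTimes (mono 0 0)
X≋xTimes-1 zero    l = refl
X≋xTimes-1 (suc j) l = refl

Y≋yTimes-1 : Y ≋ yTimes (mono 0 0)
Y≋yTimes-1 j zero    = cong indicator (∧-zeroʳ (j ≡ᵇ 0))
Y≋yTimes-1 j (suc l) = refl

X-⊗ : ∀ p → X ⊗ p ≋ xTimes p
X-⊗ p j l = begin
  (X ⊗ p) j l                   ≡⟨ ⊗-congˡ p X≋xTimes-1 j l ⟩
  (xTimes (mono 0 0) ⊗ p) j l   ≡⟨ xTimes-⊗ (mono 0 0) p j l ⟩
  xTimes (mono 0 0 ⊗ p) j l     ≡⟨ xTimes-cong (⊗-identityˡ p) j l ⟩
  xTimes p j l                  ∎

Y-⊗ : ∀ p → Y ⊗ p ≋ yTimes p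
Y-⊗ p j l = begin
  (Y ⊗ p) j l                   ≡⟨ ⊗-congˡ p Y≋yTimes-1 j l ⟩
  (yTimes (mono 0 0) ⊗ p) j l   ≡⟨ yTimes-⊗ (mono 0 0) p j l ⟩
  yTimes (mono 0 0 ⊗ p) j l     ≡⟨ yTimes-cong (⊗-identityˡ p) j l ⟩
  yTimes p j l                  ∎

const-⊗ : ∀ c p → const c ⊗ p ≋ scale c p
const-⊗ c p j l = trans (scale-⊗ c (mono 0 0) p j l) (cong (c *_) (⊗-identityˡ p j l))

const-⊗-X-⊗ : ∀ c p → const c ⊗ X ⊗ p ≋ scale c (xTimes p)
const-⊗-X-⊗ c p j l = begin
  (const c ⊗ X ⊗ p) j l   ≡⟨ ⊗-congˡ p (const-⊗ c X) j l ⟩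
  (scale c X ⊗ p) j l     ≡⟨ scale-⊗ c X p j l ⟩
  c * (X ⊗ p) j l         ≡⟨ cong (c *_) (X-⊗ p j l) ⟩
  c * xTimes p j l        ∎

const-⊗-Y-⊗ : ∀ c p → const c ⊗ Y ⊗ p ≋ scale c (yTimes p)
const-⊗-Y-⊗ c p j l = begin
  (const c ⊗ Y ⊗ p) j l   ≡⟨ ⊗-congˡ p (const-⊗ c Y) j l ⟩
  (scale c Y ⊗ p) j l     ≡⟨ scale-⊗ c Y p j l ⟩
  c * (Y ⊗ p) j l         ≡⟨ cong (c *_) (Y-⊗ p j l) ⟩
  c * yTimes p j l        ∎

x+y-⊗ : ∀ p → (X ⊕ Y) ⊗ p ≋ xTimes p ⊕ yTimes p
x+y-⊗ p j l = trans (⊗-distribʳ-⊕ X Y p j l) (cong₂ _+_ (X-⊗ p j l) (Y-⊗ p j l))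

X⊗X-⊗ : ∀ p → X ⊗ X ⊗ p ≋ xTimes (xTimes p)
X⊗X-⊗ p j l = begin
  (X ⊗ X ⊗ p) j l           ≡⟨ ⊗-congˡ p (X-⊗ X) j l ⟩
  (xTimes X ⊗ p) j l        ≡⟨ xTimes-⊗ X p j l ⟩
  xTimes (X ⊗ p) j l        ≡⟨ xTimes-cong (X-⊗ p) j l ⟩
  xTimes (xTimes p) j l     ∎

Y⊗Y-⊗ : ∀ p → Y ⊗ Y ⊗ p ≋ yTimes (yTimes p)
Y⊗Y-⊗ p j l = begin
  (Y ⊗ Y ⊗ p) j l           ≡⟨ ⊗-congˡ p (Y-⊗ Y) j l ⟩
  (yTimes Y ⊗ p) j l        ≡⟨ yTimes-⊗ Y p j l ⟩
  yTimes (Y ⊗ p) j l        ≡⟨ yTimes-cong (Y-⊗ p) j l ⟩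
  yTimes (yTimes p) j l     ∎

x²+y²+2xy-⊗ : ∀ p → (X ⊗ X ⊕ Y ⊗ Y ⊕ const 2 ⊗ X ⊗ Y) ⊗ p
                    ≋ xTimes (xTimes p) ⊕ yTimes (yTimes p) ⊕ scale 2 (xTimes (yTimes p))
x²+y²+2xy-⊗ p j l = begin
  ((X ⊗ X ⊕ Y ⊗ Y ⊕ const 2 ⊗ X ⊗ Y) ⊗ p) j l
    ≡⟨ ⊗-distribʳ-⊕ (X ⊗ X ⊕ Y ⊗ Y) (const 2 ⊗ X ⊗ Y) p j l ⟩
  ((X ⊗ X ⊕ Y ⊗ Y) ⊗ p) j l + (const 2 ⊗ X ⊗ Y ⊗ p) j l
    ≡⟨ cong (_+ (const 2 ⊗ X ⊗ Y ⊗ p) j l) (⊗-distribʳ-⊕ (X ⊗ X) (Y ⊗ Y) p j l) ⟩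
  (X ⊗ X ⊗ p) j l + (Y ⊗ Y ⊗ p) j l + (const 2 ⊗ X ⊗ Y ⊗ p) j l
    ≡⟨ cong₂ _+_ (cong₂ _+_ (X⊗X-⊗ p j l) (Y⊗Y-⊗ p j l)) mixed ⟩
  xTimes (xTimes p) j l + yTimes (yTimes p) j l + 2 * xTimes (yTimes p) j l ∎
  where
  mixed : (const 2 ⊗ X ⊗ Y ⊗ p) j l ≡ 2 * xTimes (yTimes p) j l
  mixed = begin
    (const 2 ⊗ X ⊗ Y ⊗ p) j l     ≡⟨ ⊗-congˡ p (const-⊗-X-⊗ 2 Y) j l ⟩
    (scale 2 (xTimes Y) ⊗ p) j l  ≡⟨ scale-⊗ 2 (xTimes Y) p j l ⟩
    2 * (xTimes Y ⊗ p) j l        ≡⟨ cong (2 *_) (xTimes-⊗ Y p j l) ⟩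
    2 * xTimes (Y ⊗ p) j l        ≡⟨ cong (2 *_) (xTimes-cong (Y-⊗ p) j l) ⟩
    2 * xTimes (yTimes p) j l     ∎

-- Positions of Cis₂ on a path

pathPairsOK : ∀ {A : Set} {n} → (ℕ → A → A → Bool) → Vec A n → Bool
pathPairsOK {n = n} R v =
  all (λ i → all (λ j → R (pathDist i j) (lookup v i) (lookup v j)) (allFin n)) (allFin n)

pathPairsOK-∷ : ∀ {A : Set} {n} (R : ℕ → A → A → Bool) →
  (∀ d a b → R d a b ≡ R d b a) → (∀ a → R 0 a a ≡ true) → ∀ c (w : Vec A n) →
  pathPairsOK R (c ∷ w) ≡ all (λ j → R (suc (toℕ j)) c (lookup w j)) (allFin n) ∧ pathPairsOK R w
pathPairsOK-∷ {n = n} R R-sym R-refl c w = begin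
  pathPairsOK R (c ∷ w)
    ≡⟨ all-allFin-suc (λ i → all (row i) (allFin (suc n))) ⟩
  all (row fzero) (allFin (suc n)) ∧ all (λ i → all (row (fsuc i)) (allFin (suc n))) (allFin n)
    ≡⟨ cong₂ _∧_ (trans (all-allFin-suc (row fzero)) (cong (_∧ near) (R-refl c)))
                 (all-cong (λ i → all-allFin-suc (row (fsuc i))) (allFin n)) ⟩
  near ∧ all (λ i → R (suc (toℕ i)) (lookup w i) c ∧ all (rowʷ i) (allFin n)) (allFin n)
    ≡⟨ cong (near ∧_) (all-∧ (λ i → R (suc (toℕ i)) (lookup w i) c) (λ i → all (rowʷ i) (allFin n))
                             (allFin n)) ⟩
  near ∧ (all (λ i → R (suc (toℕ i)) (lookup w i) c) (allFin n) ∧ pathPairsOK R w)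
    ≡⟨ cong (λ b → near ∧ (b ∧ pathPairsOK R w)) (all-cong (λ i → R-sym _ _ c) (allFin n)) ⟩
  near ∧ (near ∧ pathPairsOK R w)
    ≡⟨ sym (∧-assoc near near _) ⟩
  (near ∧ near) ∧ pathPairsOK R w
    ≡⟨ cong (_∧ pathPairsOK R w) (∧-idem near) ⟩
  near ∧ pathPairsOK R w ∎
  where
  row : Fin (suc n) → Fin (suc n) → Bool
  row i j = R (pathDist i j) (lookup (c ∷ w) i) (lookup (c ∷ w) j)
  rowʷ : Fin n → Fin n → Bool
  rowʷ i j = R (pathDist i j) (lookup w i) (lookup w j)
  near : Bool
  near = all (λ j → R (suc (toℕ j)) c (lookup w j)) (allFin n)

pairOK-sym : ∀ S D d a b → pairOK S D d a b ≡ pairOK S D d b a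
pairOK-sym S D d empty empty = refl
pairOK-sym S D d empty blue  = refl
pairOK-sym S D d empty red   = refl
pairOK-sym S D d blue  empty = refl
pairOK-sym S D d blue  blue  = refl
pairOK-sym S D d blue  red   = refl
pairOK-sym S D d red   empty = refl
pairOK-sym S D d red   blue  = refl
pairOK-sym S D d red   red   = refl

pairOK-unconstrained : ∀ {S D d} → d ∈ᵇ S ≡ false → d ∈ᵇ D ≡ false → ∀ a b →
                       pairOK S D d a b ≡ true
pairOK-unconstrained d∉S d∉D empty b     = refl
pairOK-unconstrained d∉S d∉D blue  empty = refl
pairOK-unconstrained d∉S d∉D blue  blue  = cong not d∉S
pairOK-unconstrained d∉S d∉D blue  red   = cong not d∉D
pairOK-unconstrained d∉S d∉D red   empty = refl
pairOK-unconstrained d∉S d∉D red   blue  = cong not d∉D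
pairOK-unconstrained d∉S d∉D red   red   = cong not d∉S

S₂ : List ℕ
S₂ = 2 ∷ []

coloured : Colour → Bool
coloured empty = false
coloured blue  = true
coloured red   = true

nextButOneColoured : ∀ {n} → Vec Colour n → Bool
nextButOneColoured (_ ∷ c ∷ _) = coloured c
nextButOneColoured _           = false

separated : ∀ {n} → Vec Colour n → Bool
separated []      = true
separated (c ∷ w) = not (coloured c ∧ nextButOneColoured w) ∧ separated w

Cis2-pairOK-2 : ∀ a b → pairOK S₂ S₂ 2 a b ≡ not (coloured a ∧ coloured b)
Cis2-pairOK-2 empty b     = refl
Cis2-pairOK-2 blue  empty = refl
Cis2-pairOK-2 blue  blue  = refl
Cis2-pairOK-2 blue  red   = refl
Cis2-pairOK-2 red   empty = refl
Cis2-pairOK-2 red   blue  = refl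
Cis2-pairOK-2 red   red   = refl

Cis2-headConstraints : ∀ {n} c (w : Vec Colour n) →
  all (λ j → pairOK S₂ S₂ (suc (toℕ j)) c (lookup w j)) (allFin n)
  ≡ not (coloured c ∧ nextButOneColoured w)
Cis2-headConstraints c []       = cong not (sym (∧-zeroʳ (coloured c)))
Cis2-headConstraints c (d ∷ []) = trans (cong (_∧ true) (pairOK-unconstrained refl refl c d))
                                        (cong not (sym (∧-zeroʳ (coloured c))))
Cis2-headConstraints {suc (suc m)} c (d ∷ e ∷ u) = trans
  (cong₂ _∧_ (pairOK-unconstrained refl refl c d)
             (cong₂ _∧_ (Cis2-pairOK-2 c e) (trans (all-tabulate headPair (fsuc ∘ fsuc)) farPairs)))
  (∧-identityʳ _)
  where
  headPair : Fin (suc (suc m)) → Bool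
  headPair j = pairOK S₂ S₂ (suc (toℕ j)) c (lookup (d ∷ e ∷ u) j)
  farPairs : all (headPair ∘ fsuc ∘ fsuc) (allFin m) ≡ true
  farPairs = all-true (λ j → pairOK-unconstrained refl refl c (lookup u j)) (allFin m)

isPositionᵇ-Cis2 : ∀ n (v : Vec Colour n) → isPositionᵇ S₂ S₂ n v ≡ separated v
isPositionᵇ-Cis2 zero    []      = refl
isPositionᵇ-Cis2 (suc n) (c ∷ w) =
  trans (pathPairsOK-∷ (pairOK S₂ S₂) (pairOK-sym S₂ S₂) (λ a → pairOK-unconstrained refl refl a a) c w)
        (cong₂ _∧_ (Cis2-headConstraints c w) (isPositionᵇ-Cis2 n w))

-- Counting colourings

countWhere : (n : ℕ) → (Vec Colour n → Bool) → ℕ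
countWhere n P = length (filterᵇ P (colourings n))

countWhere-cong : ∀ n {P Q : Vec Colour n → Bool} → (∀ v → P v ≡ Q v) →
                  countWhere n P ≡ countWhere n Q
countWhere-cong n e = cong length (filterᵇ-cong e (colourings n))

countWhere-none : ∀ n {P : Vec Colour n → Bool} → (∀ v → P v ≡ false) → countWhere n P ≡ 0
countWhere-none n e = cong length (filterᵇ-none e (colourings n))

countWhere-suc : ∀ n (P : Vec Colour (suc n) → Bool) →
  countWhere (suc n) P
  ≡ countWhere n (λ w → P (empty ∷ w)) + countWhere n (λ w → P (blue ∷ w))
    + countWhere n (λ w → P (red ∷ w))
countWhere-suc n P = go (colourings n)
  where
  extend : Vec Colour n → List (Vec Colour (suc n))
  extend v = (empty ∷ v) ∷ (blue ∷ v) ∷ (red ∷ v) ∷ []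
  headed : Colour → List (Vec Colour n) → ℕ
  headed c vs = length (filterᵇ (λ w → P (c ∷ w)) vs)
  ι : Colour → Vec Colour n → ℕ
  ι c v = indicator (P (c ∷ v))
  regroup : ∀ a b c x y z → a + (b + (c + (x + y + z))) ≡ (a + x) + (b + y) + (c + z)
  regroup = solve 6 (λ a b c x y z →
    a :+ (b :+ (c :+ (x :+ y :+ z))) := (a :+ x) :+ (b :+ y) :+ (c :+ z)) refl
  go : ∀ vs → length (filterᵇ P (concatMap extend vs))
              ≡ headed empty vs + headed blue vs + headed red vs
  go []       = refl
  go (v ∷ vs) = begin
    length (filterᵇ P ((empty ∷ v) ∷ (blue ∷ v) ∷ (red ∷ v) ∷ rest))
      ≡⟨ length-filterᵇ-∷ P (empty ∷ v) _ ⟩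
    ι empty v + length (filterᵇ P ((blue ∷ v) ∷ (red ∷ v) ∷ rest))
      ≡⟨ cong (ι empty v +_) (trans (length-filterᵇ-∷ P (blue ∷ v) _)
                                    (cong (ι blue v +_) (length-filterᵇ-∷ P (red ∷ v) rest))) ⟩
    ι empty v + (ι blue v + (ι red v + length (filterᵇ P rest)))
      ≡⟨ cong (λ t → ι empty v + (ι blue v + (ι red v + t))) (go vs) ⟩
    ι empty v + (ι blue v + (ι red v + (headed empty vs + headed blue vs + headed red vs)))
      ≡⟨ regroup (ι empty v) (ι blue v) (ι red v) (headed empty vs) (headed blue vs) (headed red vs) ⟩
    (ι empty v + headed empty vs) + (ι blue v + headed blue vs) + (ι red v + headed red vs)
      ≡⟨ sym (cong₂ _+_ (cong₂ _+_ (headed-∷ empty) (headed-∷ blue)) (headed-∷ red)) ⟩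
    headed empty (v ∷ vs) + headed blue (v ∷ vs) + headed red (v ∷ vs) ∎
    where
    rest : List (Vec Colour (suc n))
    rest = concatMap extend vs
    headed-∷ : ∀ c → headed c (v ∷ vs) ≡ ι c v + headed c vs
    headed-∷ c = length-filterᵇ-∷ (λ w → P (c ∷ w)) v vs

countWhere-emptyHead : ∀ {n} (P : Vec Colour (suc n) → Bool) →
  (∀ w → P (blue ∷ w) ≡ false) → (∀ w → P (red ∷ w) ≡ false) →
  countWhere (suc n) P ≡ countWhere n (λ w → P (empty ∷ w))
countWhere-emptyHead {n} P no-blue no-red = begin
  countWhere (suc n) P
    ≡⟨ countWhere-suc n P ⟩
  empties + countWhere n (λ w → P (blue ∷ w)) + countWhere n (λ w → P (red ∷ w))
    ≡⟨ cong₂ (λ b r → empties + b + r) (countWhere-none n no-blue) (countWhere-none n no-red) ⟩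
  empties + 0 + 0
    ≡⟨ trans (+-identityʳ _) (+-identityʳ empties) ⟩
  empties ∎
  where
  empties : ℕ
  empties = countWhere n (λ w → P (empty ∷ w))

countWhere-gap : ∀ {n} (R : Vec Colour (3 + n) → Bool) x y → coloured x ≡ true →
  countWhere (suc n) (λ w → R (x ∷ y ∷ w) ∧ separated (x ∷ y ∷ w))
  ≡ countWhere n (λ u → R (x ∷ y ∷ empty ∷ u) ∧ separated (x ∷ y ∷ empty ∷ u))
countWhere-gap R empty y ()
countWhere-gap R blue  y _ = countWhere-emptyHead (λ w → R (blue ∷ y ∷ w) ∧ separated (blue ∷ y ∷ w))
                                                  (λ _ → ∧-zeroʳ _) (λ _ → ∧-zeroʳ _)
countWhere-gap R red   y _ = countWhere-emptyHead (λ w → R (red ∷ y ∷ w) ∧ separated (red ∷ y ∷ w))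
                                                  (λ _ → ∧-zeroʳ _) (λ _ → ∧-zeroʳ _)

afterColoured : ∀ {k} → (Vec Colour (4 + k) → Bool) → Colour → ℕ
afterColoured {k} R c =
    countWhere (1 + k) (λ u → R (c ∷ empty ∷ empty ∷ u) ∧ separated u)
  + countWhere k (λ u → R (c ∷ blue ∷ empty ∷ empty ∷ u) ∧ separated u)
  + countWhere k (λ u → R (c ∷ red ∷ empty ∷ empty ∷ u) ∧ separated u)

countWhere-colouredHead : ∀ {k} (R : Vec Colour (4 + k) → Bool) c → coloured c ≡ true →
  countWhere (3 + k) (λ w → R (c ∷ w) ∧ separated (c ∷ w)) ≡ afterColoured R c
countWhere-colouredHead R empty ()
-- The blue and red clauses are the same; they are separate because separated (c ∷ d ∷ empty ∷ w)
-- only reduces to separated (d ∷ empty ∷ w) once c is a constructor.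
countWhere-colouredHead {k} R blue c-col =
  trans (countWhere-suc (2 + k) (λ w → R (blue ∷ w) ∧ separated (blue ∷ w)))
    (cong₂ _+_ (cong₂ _+_ (countWhere-gap R blue empty c-col)
                          (trans (countWhere-gap R blue blue c-col) (countWhere-gap R′ blue empty refl)))
               (trans (countWhere-gap R blue red c-col) (countWhere-gap R′ red empty refl)))
  where
  R′ : Vec Colour (3 + k) → Bool
  R′ v = R (blue ∷ v)
countWhere-colouredHead {k} R red c-col =
  trans (countWhere-suc (2 + k) (λ w → R (red ∷ w) ∧ separated (red ∷ w)))
    (cong₂ _+_ (cong₂ _+_ (countWhere-gap R red empty c-col)
                          (trans (countWhere-gap R red blue c-col) (countWhere-gap R′ blue empty refl)))
               (trans (countWhere-gap R red red c-col) (countWhere-gap R′ red empty refl)))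
  where
  R′ : Vec Colour (3 + k) → Bool
  R′ v = R (red ∷ v)

countWhere-separated : ∀ k (R : Vec Colour (4 + k) → Bool) →
  countWhere (4 + k) (λ v → R v ∧ separated v)
  ≡ countWhere (3 + k) (λ w → R (empty ∷ w) ∧ separated w)
    + afterColoured R blue + afterColoured R red
countWhere-separated k R =
  trans (countWhere-suc (3 + k) (λ v → R v ∧ separated v))
        (cong₂ _+_ (cong (countWhere (3 + k) (λ w → R (empty ∷ w) ∧ separated w) +_)
                         (countWhere-colouredHead R blue refl))
                   (countWhere-colouredHead R red refl))

-- Profiles

hasProfile : ∀ {n} → ℕ → ℕ → Vec Colour n → Bool
hasProfile j l v = (count blue v ≡ᵇ j) ∧ (count red v ≡ᵇ l)

tailProfile : ∀ {m n} → (Vec Colour m → Vec Colour n) → Poly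
tailProfile {m} f j l = countWhere m (λ u → hasProfile j l (f u) ∧ separated u)

separatedProfile : ℕ → Poly
separatedProfile n = tailProfile {n} (λ u → u)

Cis2≋separatedProfile : ∀ n → Cis2 n ≋ separatedProfile n
Cis2≋separatedProfile n j l = begin
  length (filterᵇ (hasProfile j l) (filterᵇ (isPositionᵇ S₂ S₂ n) (colourings n)))
    ≡⟨ cong length (filterᵇ-filterᵇ (isPositionᵇ S₂ S₂ n) (hasProfile j l) (colourings n)) ⟩
  countWhere n (λ v → isPositionᵇ S₂ S₂ n v ∧ hasProfile j l v)
    ≡⟨ countWhere-cong n (λ v → trans (cong (_∧ hasProfile j l v) (isPositionᵇ-Cis2 n v))
                                      (∧-comm (separated v) (hasProfile j l v))) ⟩
  separatedProfile n j l ∎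

colourTimes : Colour → Poly → Poly
colourTimes empty p = p
colourTimes blue  p = xTimes p
colourTimes red   p = yTimes p

colourTimes-cong : ∀ c {p q} → p ≋ q → colourTimes c p ≋ colourTimes c q
colourTimes-cong empty e = e
colourTimes-cong blue  e = xTimes-cong e
colourTimes-cong red   e = yTimes-cong e

tailProfile-∷ : ∀ {m n} c (f : Vec Colour m → Vec Colour n) →
  tailProfile (λ u → c ∷ f u) ≋ colourTimes c (tailProfile f)
tailProfile-∷     empty f j       l       = refl
tailProfile-∷ {m} blue  f zero    l       = countWhere-none m (λ _ → refl)
tailProfile-∷     blue  f (suc j) l       = refl
tailProfile-∷ {m} red   f j       zero    = countWhere-none m (λ u → cong (_∧ separated u) (∧-zeroʳ _))
tailProfile-∷     red   f j       (suc l) = refl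

afterColoured-hasProfile : ∀ k c j l →
  afterColoured {k} (hasProfile j l) c
  ≡ colourTimes c (separatedProfile (1 + k)) j l
    + colourTimes c (xTimes (separatedProfile k)) j l
    + colourTimes c (yTimes (separatedProfile k)) j l
afterColoured-hasProfile k c j l =
  cong₂ _+_ (cong₂ _+_ (tailProfile-∷ c (λ (u : Vec Colour (1 + k)) → empty ∷ empty ∷ u) j l)
                       (trans (tailProfile-∷ c (λ u → blue ∷ gap u) j l)
                              (colourTimes-cong c (tailProfile-∷ blue gap) j l)))
            (trans (tailProfile-∷ c (λ u → red ∷ gap u) j l)
                   (colourTimes-cong c (tailProfile-∷ red gap) j l))
  where
  gap : Vec Colour k → Vec Colour (2 + k)
  gap u = empty ∷ empty ∷ u

separatedProfile-rec : ∀ k →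
  separatedProfile (4 + k)
  ≋ separatedProfile (3 + k)
    ⊕ (xTimes (separatedProfile (1 + k)) ⊕ yTimes (separatedProfile (1 + k)))
    ⊕ (xTimes (xTimes (separatedProfile k)) ⊕ yTimes (yTimes (separatedProfile k))
       ⊕ scale 2 (xTimes (yTimes (separatedProfile k))))
separatedProfile-rec k j l = begin
  separatedProfile (4 + k) j l
    ≡⟨ countWhere-separated k (hasProfile j l) ⟩
  a + afterColoured {k} (hasProfile j l) blue + afterColoured {k} (hasProfile j l) red
    ≡⟨ cong₂ (λ b r → a + b + r) (afterColoured-hasProfile k blue j l)
                                 (afterColoured-hasProfile k red j l) ⟩
  a + (x + xx + xy) + (y + yTimes (xTimes p₀) j l + yy)
    ≡⟨ cong (λ t → a + (x + xx + xy) + (y + t + yy)) (yTimes-xTimes p₀ j l) ⟩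
  a + (x + xx + xy) + (y + xy + yy)
    ≡⟨ regroup a x y xx yy xy ⟩
  a + (x + y) + (xx + yy + 2 * xy) ∎
  where
  p₁ p₀ : Poly
  p₁ = separatedProfile (1 + k)
  p₀ = separatedProfile k
  a x y xx yy xy : ℕ
  a  = separatedProfile (3 + k) j l
  x  = xTimes p₁ j l
  y  = yTimes p₁ j l
  xx = xTimes (xTimes p₀) j l
  yy = yTimes (yTimes p₀) j l
  xy = xTimes (yTimes p₀) j l
  regroup : ∀ a x y xx yy xy → a + (x + xx + xy) + (y + xy + yy) ≡ a + (x + y) + (xx + yy + 2 * xy)
  regroup = solve 6 (λ a x y xx yy xy →
    a :+ (x :+ xx :+ xy) :+ (y :+ xy :+ yy) := a :+ (x :+ y) :+ (xx :+ yy :+ con 2 :* xy)) refl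

Cis2-rec : (n : ℕ) → 4 ≤ n →
  Cis2 n ≋ Cis2 (n ∸ 1) ⊕ (X ⊕ Y) ⊗ Cis2 (n ∸ 3) ⊕ (X ⊗ X ⊕ Y ⊗ Y ⊕ const 2 ⊗ X ⊗ Y) ⊗ Cis2 (n ∸ 4)
Cis2-rec (suc (suc (suc (suc k)))) (s≤s (s≤s (s≤s (s≤s _)))) j l = begin
  Cis2 (4 + k) j l
    ≡⟨ Cis2≋separatedProfile (4 + k) j l ⟩
  separatedProfile (4 + k) j l
    ≡⟨ separatedProfile-rec k j l ⟩
  p₃ j l + (xTimes p₁ ⊕ yTimes p₁) j l
    + (xTimes (xTimes p₀) ⊕ yTimes (yTimes p₀) ⊕ scale 2 (xTimes (yTimes p₀))) j l
    ≡⟨ sym (cong₂ _+_ (cong (p₃ j l +_) (x+y-⊗ p₁ j l)) (x²+y²+2xy-⊗ p₀ j l)) ⟩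
  p₃ j l + ((X ⊕ Y) ⊗ p₁) j l + (Q ⊗ p₀) j l
    ≡⟨ sym (cong₂ _+_ (cong₂ _+_ (Cis2≋separatedProfile (3 + k) j l)
                                 (⊗-congʳ (X ⊕ Y) (Cis2≋separatedProfile (1 + k)) j l))
                      (⊗-congʳ Q (Cis2≋separatedProfile k) j l)) ⟩
  (Cis2 (3 + k) ⊕ (X ⊕ Y) ⊗ Cis2 (1 + k) ⊕ Q ⊗ Cis2 k) j l ∎
  where
  p₃ p₁ p₀ Q : Poly
  p₃ = separatedProfile (3 + k)
  p₁ = separatedProfile (1 + k)
  p₀ = separatedProfile k
  Q  = X ⊗ X ⊕ Y ⊗ Y ⊕ const 2 ⊗ X ⊗ Y

separatedCount-rec : ∀ k →
  countWhere (4 + k) separated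
  ≡ countWhere (3 + k) separated + 2 * countWhere (1 + k) separated + 4 * countWhere k separated
separatedCount-rec k =
  trans (countWhere-separated k (λ _ → true))
        (regroup (countWhere (3 + k) separated) (countWhere (1 + k) separated) (countWhere k separated))
  where
  regroup : ∀ a b c → a + (b + c + c) + (b + c + c) ≡ a + 2 * b + 4 * c
  regroup = solve 3 (λ a b c → a :+ (b :+ c :+ c) :+ (b :+ c :+ c) := a :+ con 2 :* b :+ con 4 :* c) refl

count-≤ : ∀ c {n} (v : Vec Colour n) → count c v ≤ n
count-≤ c     []          = z≤n
count-≤ empty (empty ∷ v) = s≤s (count-≤ empty v)
count-≤ empty (blue  ∷ v) = m≤n⇒m≤1+n (count-≤ empty v)
count-≤ empty (red   ∷ v) = m≤n⇒m≤1+n (count-≤ empty v)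
count-≤ blue  (empty ∷ v) = m≤n⇒m≤1+n (count-≤ blue v)
count-≤ blue  (blue  ∷ v) = s≤s (count-≤ blue v)
count-≤ blue  (red   ∷ v) = m≤n⇒m≤1+n (count-≤ blue v)
count-≤ red   (empty ∷ v) = m≤n⇒m≤1+n (count-≤ red v)
count-≤ red   (blue  ∷ v) = m≤n⇒m≤1+n (count-≤ red v)
count-≤ red   (red   ∷ v) = s≤s (count-≤ red v)

hasProfile-unique : ∀ {n} (v : Vec Colour n) →
                    Σ≤ n (λ j → Σ≤ n (λ l → indicator (hasProfile j l v))) ≡ 1
hasProfile-unique {n} v = trans (Σ≤-cong n redSum) (Σ≤-indicator-≡ᵇ (count-≤ blue v))
  where
  redSum : ∀ j → Σ≤ n (λ l → indicator ((count blue v ≡ᵇ j) ∧ (count red v ≡ᵇ l)))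
                 ≡ indicator (count blue v ≡ᵇ j)
  redSum j with count blue v ≡ᵇ j
  ... | true  = Σ≤-indicator-≡ᵇ (count-≤ red v)
  ... | false = Σ≤-zero n

Σ≤-Σ≤-hasProfile : ∀ {n} (vs : List (Vec Colour n)) →
  Σ≤ n (λ j → Σ≤ n (λ l → length (filterᵇ (hasProfile j l) vs))) ≡ length vs
Σ≤-Σ≤-hasProfile {n} []       = trans (Σ≤-cong n (λ _ → Σ≤-zero n)) (Σ≤-zero n)
Σ≤-Σ≤-hasProfile {n} (v ∷ vs) = begin
  Σ≤ n (λ j → Σ≤ n (λ l → length (filterᵇ (hasProfile j l) (v ∷ vs))))
    ≡⟨ Σ≤-cong n (λ j → trans (Σ≤-cong n (λ l → length-filterᵇ-∷ (hasProfile j l) v vs))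
                              (Σ≤-+ n (λ l → indicator (hasProfile j l v)) (len j))) ⟩
  Σ≤ n (λ j → Σ≤ n (λ l → indicator (hasProfile j l v)) + Σ≤ n (len j))
    ≡⟨ Σ≤-+ n (λ j → Σ≤ n (λ l → indicator (hasProfile j l v))) (λ j → Σ≤ n (len j)) ⟩
  Σ≤ n (λ j → Σ≤ n (λ l → indicator (hasProfile j l v))) + Σ≤ n (λ j → Σ≤ n (len j))
    ≡⟨ cong₂ _+_ (hasProfile-unique v) (Σ≤-Σ≤-hasProfile vs) ⟩
  suc (length vs) ∎
  where
  len : ℕ → ℕ → ℕ
  len j l = length (filterᵇ (hasProfile j l) vs)

eval11-Cis2 : ∀ n → eval11 n (Cis2 n) ≡ countWhere n separated
eval11-Cis2 n =
  trans (Σ≤-Σ≤-hasProfile (positions S₂ S₂ n)) (countWhere-cong n (isPositionᵇ-Cis2 n))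


eval11-Cis2-rec : (n : ℕ) → 4 ≤ n →
  eval11 n (Cis2 n)
  ≡ eval11 (n ∸ 1) (Cis2 (n ∸ 1)) + 2 * eval11 (n ∸ 3) (Cis2 (n ∸ 3)) + 4 * eval11 (n ∸ 4) (Cis2 (n ∸ 4))
eval11-Cis2-rec (suc (suc (suc (suc k)))) (s≤s (s≤s (s≤s (s≤s _)))) = begin
  eval11 (4 + k) (Cis2 (4 + k))
    ≡⟨ eval11-Cis2 (4 + k) ⟩
  countWhere (4 + k) separated
    ≡⟨ separatedCount-rec k ⟩
  countWhere (3 + k) separated + 2 * countWhere (1 + k) separated + 4 * countWhere k separated
    ≡⟨ sym (cong₂ _+_ (cong₂ _+_ (eval11-Cis2 (3 + k)) (cong (2 *_) (eval11-Cis2 (1 + k))))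
                      (cong (4 *_) (eval11-Cis2 k))) ⟩
  eval11 (3 + k) (Cis2 (3 + k)) + 2 * eval11 (1 + k) (Cis2 (1 + k)) + 4 * eval11 k (Cis2 k) ∎

-- Initial values

Cis2-0 : Cis2 0 ≋ const 1
Cis2-0 zero    zero    = refl
Cis2-0 zero    (suc l) = refl
Cis2-0 (suc j) zero    = refl
Cis2-0 (suc j) (suc l) = refl

Cis2-1 : Cis2 1 ≋ const 1 ⊕ X ⊕ Y
Cis2-1 0                   0                   = refl
Cis2-1 0                   1                   = refl
Cis2-1 0                   (suc (suc l))       = refl
Cis2-1 1                   0                   = refl
Cis2-1 1                   1                   = refl
Cis2-1 1                   (suc (suc l))       = refl
Cis2-1 (suc (suc j))       0                   = refl
Cis2-1 (suc (suc j))       1                   = refl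
Cis2-1 (suc (suc j))       (suc (suc l))       = refl

Cis2-2 : Cis2 2 ≋ const 1 ⊕ const 2 ⊗ X ⊕ const 2 ⊗ Y ⊕ X ⊗ X ⊕ Y ⊗ Y
                 ⊕ const 2 ⊗ X ⊗ Y
Cis2-2 j l = trans (coefficients j l)
  (sym (cong₂ _+_ (cong₂ _+_ (cong₂ _+_ (cong₂ _+_ (cong (const 1 j l +_) (const-⊗ 2 X j l))
                                                   (const-⊗ 2 Y j l))
                                        (X-⊗ X j l))
                             (Y-⊗ Y j l))
                  (const-⊗-X-⊗ 2 Y j l)))
  where
  coefficients : ∀ j l →
    Cis2 2 j l ≡ const 1 j l + 2 * X j l + 2 * Y j l + xTimes X j l + yTimes Y j l + 2 * xTimes Y j l
  coefficients 0                         0                         = refl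
  coefficients 0                         1                         = refl
  coefficients 0                         2                         = refl
  coefficients 0                   (suc (suc (suc l))) = refl
  coefficients 1                         0                         = refl
  coefficients 1                         1                         = refl
  coefficients 1                         2                         = refl
  coefficients 1                   (suc (suc (suc l))) = refl
  coefficients 2                         0                         = refl
  coefficients 2                         1                         = refl
  coefficients 2                         2                         = refl
  coefficients 2                   (suc (suc (suc l))) = refl
  coefficients (suc (suc (suc j))) 0                   = refl
  coefficients (suc (suc (suc j))) 1                   = refl
  coefficients (suc (suc (suc j))) 2                   = refl
  coefficients (suc (suc (suc j))) (suc (suc (suc l))) = refl

Cis2-3 : Cis2 3 ≋ const 1 ⊕ const 3 ⊗ X ⊕ const 3 ⊗ Y ⊕ const 2 ⊗ X ⊗ X ⊕ const 2 ⊗ Y ⊗ Y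
                 ⊕ const 4 ⊗ X ⊗ Y
Cis2-3 j l = trans (coefficients j l)
  (sym (cong₂ _+_ (cong₂ _+_ (cong₂ _+_ (cong₂ _+_ (cong (const 1 j l +_) (const-⊗ 3 X j l))
                                                   (const-⊗ 3 Y j l))
                                        (const-⊗-X-⊗ 2 X j l))
                             (const-⊗-Y-⊗ 2 Y j l))
                  (const-⊗-X-⊗ 4 Y j l)))
  where
  coefficients : ∀ j l →
    Cis2 3 j l ≡ const 1 j l + 3 * X j l + 3 * Y j l + 2 * xTimes X j l + 2 * yTimes Y j l + 4 * xTimes Y j l
  coefficients 0                         0                         = refl
  coefficients 0                         1                         = refl
  coefficients 0                         2                         = refl
  coefficients 0                         3                         = refl
  coefficients 0                         (suc (suc (suc (suc l)))) = refl
  coefficients 1                         0                         = refl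
  coefficients 1                         1                         = refl
  coefficients 1                         2                         = refl
  coefficients 1                         3                         = refl
  coefficients 1                         (suc (suc (suc (suc l)))) = refl
  coefficients 2                         0                         = refl
  coefficients 2                         1                         = refl
  coefficients 2                         2                         = refl
  coefficients 2                         3                         = refl
  coefficients 2                         (suc (suc (suc (suc l)))) = refl
  coefficients 3                         0                         = refl
  coefficients 3                         1                         = refl
  coefficients 3                         2                         = refl
  coefficients 3                         3                         = refl
  coefficients 3                         (suc (suc (suc (suc l)))) = refl
  coefficients (suc (suc (suc (suc j)))) 0                         = refl
  coefficients (suc (suc (suc (suc j)))) 1                         = refl
  coefficients (suc (suc (suc (suc j)))) 2                         = refl
  coefficients (suc (suc (suc (suc j)))) 3                         = refl
  coefficients (suc (suc (suc (suc j)))) (suc (suc (suc (suc l)))) = refl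

mainTheorem4 :
  ((n : ℕ) → 4 ≤ n →
    Cis2 n ≋ Cis2 (n ∸ 1) ⊕ (X ⊕ Y) ⊗ Cis2 (n ∸ 3)
              ⊕ (X ⊗ X ⊕ Y ⊗ Y ⊕ const 2 ⊗ X ⊗ Y) ⊗ Cis2 (n ∸ 4))
  × (Cis2 0 ≋ const 1)
  × (Cis2 1 ≋ const 1 ⊕ X ⊕ Y)
  × (Cis2 2 ≋ const 1 ⊕ const 2 ⊗ X ⊕ const 2 ⊗ Y ⊕ X ⊗ X ⊕ Y ⊗ Y ⊕ const 2 ⊗ X ⊗ Y)
  × (Cis2 3 ≋ const 1 ⊕ const 3 ⊗ X ⊕ const 3 ⊗ Y ⊕ const 2 ⊗ X ⊗ X ⊕ const 2 ⊗ Y ⊗ Y ⊕ const 4 ⊗ X ⊗ Y)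
  × ((n : ℕ) → 4 ≤ n →
    eval11 n (Cis2 n) ≡ eval11 (n ∸ 1) (Cis2 (n ∸ 1)) + 2 * eval11 (n ∸ 3) (Cis2 (n ∸ 3)) + 4 * eval11 (n ∸ 4) (Cis2 (n ∸ 4)))
  × (eval11 0 (Cis2 0) ≡ 1)
  × (eval11 1 (Cis2 1) ≡ 3)
  × (eval11 2 (Cis2 2) ≡ 9)
  × (eval11 3 (Cis2 3) ≡ 15)
mainTheorem4 =
  Cis2-rec , Cis2-0 , Cis2-1 , Cis2-2 , Cis2-3 , eval11-Cis2-rec , refl , refl , refl , refl
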